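{- The calculi $\mathtt{SkMBiCT}$ and $\mathtt{SkMBiCA}$ are equivalent: (1) for any formulae $A, C$, if $A \vdash_{\mathsf{L}} C$ is derivable in $\mathtt{SkMBiCA}$, then the sequent $A \vdash_{\mathsf{T}} C$ (with the single-formula tree $A$) is derivable in $\mathtt{SkMBiCT}$; (2) for any tree $T$ and formula $C$, if $T \vdash_{\mathsf{T}} C$ is derivable in $\mathtt{SkMBiCT}$, then $T^{\#} \vdash_{\mathsf{L}} C$ is derivable in $\mathtt{SkMBiCA}$.
   Context: Formulae are generated by $A,B ::= X \mid \mathsf{I} \mid A \otimes^{\mathsf{L}} B \mid A \multimap^{\mathsf{L}} B \mid A \otimes^{\mathsf{R}} B \mid A \multimap^{\mathsf{R}} B$, with $X$ ranging over a set of atoms. $\mathtt{SkMBiCA}$ has sequents $A \vdash_{\mathsf{L}} B$ between formulae, generated by: (id) $A\vdash_{\mathsf{L}} A$; (comp) from $A \vdash_{\mathsf{L}} B$ and $B \vdash_{\mathsf{L}} C$ infer $A \vdash_{\mathsf{L}} C$; ($\otimes^{\mathsf{L}}$) from $A\vdash_{\mathsf{L}} C$ and $B \vdash_{\mathsf{L}} D$ infer $A\otimes^{\mathsf{L}} B \vdash_{\mathsf{L}} C \otimes^{\mathsf{L}} D$; ($\multimap^{\mathsf{L}}$) from $C \vdash_{\mathsf{L}} A$ and $B \vdash_{\mathsf{L}} D$ infer $A\multimap^{\mathsf{L}} B \vdash_{\mathsf{L}} C\multimap^{\mathsf{L}} D$; ($\multimap^{\mathsf{R}}$) from $C \vdash_{\mathsf{L}}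 A$ and $B \vdash_{\mathsf{L}} D$ infer $A\multimap^{\mathsf{R}} B \vdash_{\mathsf{L}} C\multimap^{\mathsf{R}} D$; axioms ($\lambda$) $\mathsf{I}\otimes^{\mathsf{L}} A \vdash_{\mathsf{L}} A$, ($\rho$) $A \vdash_{\mathsf{L}} A \otimes^{\mathsf{L}} \mathsf{I}$, ($\alpha$) $(A\otimes^{\mathsf{L}} B)\otimes^{\mathsf{L}} C \vdash_{\mathsf{L}} A \otimes^{\mathsf{L}}(B\otimes^{\mathsf{L}} C)$, ($\gamma$) $A \otimes^{\mathsf{L}} B \vdash_{\mathsf{L}} B \otimes^{\mathsf{R}} A$, ($\gamma^{ -1}$) $A \otimes^{\mathsf{R}} B \vdash_{\mathsf{L}} B \otimes^{\mathsf{L}} A$; and the bidirectional rules ($\pi$) $A \vdash_{\mathsf{L}} B \multimap^{\mathsf{L}} C$ iff $A \otimes^{\mathsf{L}} B \vdash_{\mathsf{L}} C$, ($\pi^{\mathsf{R}}$) $A \vdash_{\mathsf{L}} B \multimap^{\mathsf{R}} C$ iff $A \otimes^{\mathsf{R}} B \vdash_{\mathsf{L}} C$. $\mathtt{SkMBiCT}$: trees $T ::= A \mid { - } \mid (T,T) \mid (T;T)$ (${ - }$ the empty tree); contexts are trees with one hole, $T[U]$ is substitution. Sequents $T \vdash_{\mathsf{T}} A$, generated by: (ax) $A \vdash_{\mathsf{T}} A$; (IR) ${ - } \vdash_{\mathsf{T}} \mathsf{I}$; (IL) from $T[{ - }] \vdash_{\mathsf{T}} C$ infer $T[\mathsf{I}]\vdash_{\mathsf{T}}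 C$; ($\otimes^{\mathsf{L}}$L) from $T[A,B] \vdash_{\mathsf{T}} C$ infer $T[A\otimes^{\mathsf{L}} B] \vdash_{\mathsf{T}} C$; ($\otimes^{\mathsf{L}}$R) from $T\vdash_{\mathsf{T}} A$ and $U \vdash_{\mathsf{T}} B$ infer $T,U \vdash_{\mathsf{T}} A \otimes^{\mathsf{L}} B$; ($\otimes^{\mathsf{R}}$L) from $T[A;B] \vdash_{\mathsf{T}} C$ infer $T[A\otimes^{\mathsf{R}} B] \vdash_{\mathsf{T}} C$; ($\otimes^{\mathsf{R}}$R) from $T\vdash_{\mathsf{T}} A$ and $U \vdash_{\mathsf{T}} B$ infer $T;U \vdash_{\mathsf{T}} A \otimes^{\mathsf{R}} B$; ($\multimap^{\mathsf{L}}$L) from $U \vdash_{\mathsf{T}} A$ and $T[B]\vdash_{\mathsf{T}} C$ infer $T[A\multimap^{\mathsf{L}} B, U] \vdash_{\mathsf{T}} C$; ($\multimap^{\mathsf{L}}$R) from $T, A \vdash_{\mathsf{T}} B$ infer $T \vdash_{\mathsf{T}} A \multimap^{\mathsf{L}} B$; ($\multimap^{\mathsf{R}}$L) from $U \vdash_{\mathsf{T}} A$ and $T[B]\vdash_{\mathsf{T}} C$ infer $T[A\multimap^{\mathsf{R}} B ; U] \vdash_{\mathsf{T}} C$; ($\multimap^{\mathsf{R}}$R) from $T ; A \vdash_{\mathsf{T}} B$ infer $T \vdash_{\mathsf{T}} A \multimap^{\mathsf{R}} B$; (assoc$^{\mathsf{L}}$) from $T[U_0,(U_1,U_2)] \vdash_{\mathsf{T}}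 C$ infer $T[(U_0,U_1),U_2]\vdash_{\mathsf{T}} C$; ($\otimes$comm, both directions) $T[U_0,U_1] \vdash_{\mathsf{T}} C$ iff $T[U_1;U_0] \vdash_{\mathsf{T}} C$; (assoc$^{\mathsf{R}}$) from $T[(U_0;U_1);U_2] \vdash_{\mathsf{T}} C$ infer $T[U_0;(U_1;U_2)]\vdash_{\mathsf{T}} C$; (unitL$^{\mathsf{L}}$) from $T[U]\vdash_{\mathsf{T}} C$ infer $T[{ - },U] \vdash_{\mathsf{T}} C$; (unitR$^{\mathsf{L}}$) from $T[U,{ - }]\vdash_{\mathsf{T}} C$ infer $T[U]\vdash_{\mathsf{T}} C$; (unitL$^{\mathsf{R}}$) from $T[U]\vdash_{\mathsf{T}} C$ infer $T[U;{ - }] \vdash_{\mathsf{T}} C$; (unitR$^{\mathsf{R}}$) from $T[{ - };U]\vdash_{\mathsf{T}} C$ infer $T[U]\vdash_{\mathsf{T}} C$. For a tree $T$, $T^{\#}$ is the formula obtained by replacing commas by $\otimes^{\mathsf{L}}$, semicolons by $\otimes^{\mathsf{R}}$ and ${ - }$ by $\mathsf{I}$: $A^{\#}=A$, ${ - }^{\#}=\mathsf{I}$, $(T_1,T_2)^{\#} = T_1^{\#}\otimes^{\mathsf{L}} T_2^{\#}$, $(T_1;T_2)^{\#} = T_1^{\#}\otimes^{\mathsf{R}} T_2^{\#}$. -}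

module Defs where

module Calculi (At : Set) where

  infixr 25 _⊗L_ _⊗R_
  infixr 20 _⊸L_ _⊸R_

  data Fma : Set where
    at    : At → Fma
    I     : Fma
    _⊗L_  : Fma → Fma → Fma
    _⊸L_  : Fma → Fma → Fma
    _⊗R_  : Fma → Fma → Fma
    _⊸R_  : Fma → Fma → Fma

  infix 5 _⊢L_
  data _⊢L_ : Fma → Fma → Set where
    id    : ∀ {A} → A ⊢L A
    comp  : ∀ {A B C} → A ⊢L B → B ⊢L C → A ⊢L C
    ⊗L-f  : ∀ {A B C D} → A ⊢L C → B ⊢L D → A ⊗L B ⊢L C ⊗L D
    ⊸L-f  : ∀ {A B C D} → C ⊢L A → B ⊢L D → A ⊸L B ⊢L C ⊸L D
    ⊸R-f  : ∀ {A B C D} → C ⊢L A → B ⊢L D → A ⊸R B ⊢L C ⊸R D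
    λ'    : ∀ {A} → I ⊗L A ⊢L A
    ρ     : ∀ {A} → A ⊢L A ⊗L I
    α     : ∀ {A B C} → (A ⊗L B) ⊗L C ⊢L A ⊗L (B ⊗L C)
    γ     : ∀ {A B} → A ⊗L B ⊢L B ⊗R A
    γ⁻¹   : ∀ {A B} → A ⊗R B ⊢L B ⊗L A
    π     : ∀ {A B C} → A ⊗L B ⊢L C → A ⊢L B ⊸L C
    π⁻¹   : ∀ {A B C} → A ⊢L B ⊸L C → A ⊗L B ⊢L C
    πR    : ∀ {A B C} → A ⊗R B ⊢L C → A ⊢L B ⊸R C
    πR⁻¹  : ∀ {A B C} → A ⊢L B ⊸R C → A ⊗R B ⊢L C

  data Tree : Set where
    fma  : Fma → Tree
    ─    : Tree
    _,,_ : Tree → Tree → Tree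
    _︔_ : Tree → Tree → Tree

  data Ctx : Set where
    ∙    : Ctx
    _,ₗ_ : Ctx → Tree → Ctx
    _,ᵣ_ : Tree → Ctx → Ctx
    _︔ₗ_ : Ctx → Tree → Ctx
    _︔ᵣ_ : Tree → Ctx → Ctx

  _[_] : Ctx → Tree → Tree
  ∙ [ U ] = U
  (T ,ₗ V) [ U ] = (T [ U ]) ,, V
  (V ,ᵣ T) [ U ] = V ,, (T [ U ])
  (T ︔ₗ V) [ U ] = (T [ U ]) ︔ V
  (V ︔ᵣ T) [ U ] = V ︔ (T [ U ])

  infix 5 _⊢T_
  data _⊢T_ : Tree → Fma → Set where
    ax      : ∀ {A} → fma A ⊢T A
    IR      : ─ ⊢T I
    IL      : ∀ T {C} → T [ ─ ] ⊢T C → T [ fma I ] ⊢T C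
    ⊗LL     : ∀ T {A B C} → T [ fma A ,, fma B ] ⊢T C → T [ fma (A ⊗L B) ] ⊢T C
    ⊗LR     : ∀ {T U A B} → T ⊢T A → U ⊢T B → T ,, U ⊢T A ⊗L B
    ⊗RL     : ∀ T {A B C} → T [ fma A ︔ fma B ] ⊢T C → T [ fma (A ⊗R B) ] ⊢T C
    ⊗RR     : ∀ {T U A B} → T ⊢T A → U ⊢T B → T ︔ U ⊢T A ⊗R B
    ⊸LL     : ∀ T {U A B C} → U ⊢T A → T [ fma B ] ⊢T C → T [ fma (A ⊸L B) ,, U ] ⊢T C
    ⊸LR     : ∀ {T A B} → T ,, fma A ⊢T B → T ⊢T A ⊸L B
    ⊸RL     : ∀ T {U A B C} → U ⊢T A → T [ fma B ] ⊢T C → T [ fma (A ⊸R B) ︔ U ] ⊢T C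
    ⊸RR     : ∀ {T A B} → T ︔ fma A ⊢T B → T ⊢T A ⊸R B
    assocL  : ∀ T {U₀ U₁ U₂ C} → T [ U₀ ,, (U₁ ,, U₂) ] ⊢T C → T [ (U₀ ,, U₁) ,, U₂ ] ⊢T C
    comm    : ∀ T {U₀ U₁ C} → T [ U₀ ,, U₁ ] ⊢T C → T [ U₁ ︔ U₀ ] ⊢T C
    comm⁻¹  : ∀ T {U₀ U₁ C} → T [ U₁ ︔ U₀ ] ⊢T C → T [ U₀ ,, U₁ ] ⊢T C
    assocR  : ∀ T {U₀ U₁ U₂ C} → T [ (U₀ ︔ U₁) ︔ U₂ ] ⊢T C → T [ U₀ ︔ (U₁ ︔ U₂) ] ⊢T C
    unitLL  : ∀ T {U C} → T [ U ] ⊢T C → T [ ─ ,, U ] ⊢T C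
    unitRL  : ∀ T {U C} → T [ U ,, ─ ] ⊢T C → T [ U ] ⊢T C
    unitLR  : ∀ T {U C} → T [ U ] ⊢T C → T [ U ︔ ─ ] ⊢T C
    unitRR  : ∀ T {U C} → T [ ─ ︔ U ] ⊢T C → T [ U ] ⊢T C

  _# : Tree → Fma
  fma A # = A
  ─ # = I
  (T ,, U) # = (T #) ⊗L (U #)
  (T ︔ U) # = (T #) ⊗R (U #)

-- Direction (2) is a direct induction: every rule of the tree calculus is interpreted by a
-- SkMBiCA arrow between the formulae T #, using that contexts act functorially on ⊢L.
-- Direction (1) reduces to cut admissibility in the tree calculus, since comp and π⁻¹ are
-- cuts in disguise.  A cut of U ⊢T A into T [ A ] ⊢T C is first pushed up the right
-- derivation; when A becomes principal in a left rule, it is pushed up the left derivation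
-- until that ends in the matching right rule, where it is replaced by cuts on the immediate
-- subformulas of A.  Pushing a cut past a rule that rewrites a subtree W requires knowing
-- whether the occurrence of A lies inside W or apart from it.
module Submission where

open import Defs
open import Data.Empty using (⊥-elim)
open import Data.Product using (_×_; _,_; proj₁; proj₂)
open import Relation.Nullary using (¬_)
open import Relation.Binary.PropositionalEquality
  using (_≡_; refl; sym; trans; cong; subst)

module Equivalence (At : Set) where
  open Calculi At

  variable
    A A′ B C C′ X Y : Fma
    U U′ V V′ W W′ : Tree
    K L : Ctx

  infixl 30 _⊚_
  _⊚_ : Ctx → Ctx → Ctx
  ∙ ⊚ L = L
  (K ,ₗ V) ⊚ L = (K ⊚ L) ,ₗ V
  (V ,ᵣ K) ⊚ L = V ,ᵣ (K ⊚ L)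
  (K ︔ₗ V) ⊚ L = (K ⊚ L) ︔ₗ V
  (V ︔ᵣ K) ⊚ L = V ︔ᵣ (K ⊚ L)

  ⊚-[] : ∀ K L U → (K ⊚ L) [ U ] ≡ K [ L [ U ] ]
  ⊚-[] ∙ L U = refl
  ⊚-[] (K ,ₗ V) L U = cong (_,, V) (⊚-[] K L U)
  ⊚-[] (V ,ᵣ K) L U = cong (V ,,_) (⊚-[] K L U)
  ⊚-[] (K ︔ₗ V) L U = cong (_︔ V) (⊚-[] K L U)
  ⊚-[] (V ︔ᵣ K) L U = cong (V ︔_) (⊚-[] K L U)

  ⊚-assoc : ∀ K L M → (K ⊚ L) ⊚ M ≡ K ⊚ (L ⊚ M)
  ⊚-assoc ∙ L M = refl
  ⊚-assoc (K ,ₗ V) L M = cong (_,ₗ V) (⊚-assoc K L M)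
  ⊚-assoc (V ,ᵣ K) L M = cong (V ,ᵣ_) (⊚-assoc K L M)
  ⊚-assoc (K ︔ₗ V) L M = cong (_︔ₗ V) (⊚-assoc K L M)
  ⊚-assoc (V ︔ᵣ K) L M = cong (V ︔ᵣ_) (⊚-assoc K L M)

  ,,-injective : U ,, V ≡ U′ ,, V′ → U ≡ U′ × V ≡ V′
  ,,-injective refl = refl , refl

  ︔-injective : U ︔ V ≡ U′ ︔ V′ → U ≡ U′ × V ≡ V′
  ︔-injective refl = refl , refl

  ─≢[fma] : ∀ K → ¬ (─ ≡ K [ fma A ])
  ─≢[fma] ∙ ()
  ─≢[fma] (_ ,ₗ _) ()
  ─≢[fma] (_ ,ᵣ _) ()
  ─≢[fma] (_ ︔ₗ _) ()
  ─≢[fma] (_ ︔ᵣ _) ()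

  cast : U ≡ V → U ⊢T C → V ⊢T C
  cast = subst (_⊢T _)

  -- How an occurrence L [ fma A ] sits relative to the subtree W of K [ W ].  In the apart
  -- case, F X [ Y ] ≡ G Y [ X ] is the tree with X in place of W and Y in place of A.
  data Overlap (K : Ctx) (W : Tree) (L : Ctx) (A : Fma) : Set where
    nested : ∀ M → W ≡ M [ fma A ] → L ≡ K ⊚ M → Overlap K W L A
    apart  : (F G : Tree → Ctx) → (∀ X Y → F X [ Y ] ≡ G Y [ X ])
           → K ≡ G (fma A) → L ≡ F W → Overlap K W L A

  overlap-⊚ : ∀ K₀ → Overlap K W L A → Overlap (K₀ ⊚ K) W (K₀ ⊚ L) A
  overlap-⊚ {K = K} K₀ (nested M inW refl) = nested M inW (sym (⊚-assoc K₀ K M))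
  overlap-⊚ K₀ (apart F G swap refl refl) =
    apart (λ X → K₀ ⊚ F X) (λ Y → K₀ ⊚ G Y) swap₀ refl refl
    where
    swap₀ : ∀ X Y → (K₀ ⊚ F X) [ Y ] ≡ (K₀ ⊚ G Y) [ X ]
    swap₀ X Y = trans (⊚-[] K₀ (F X) Y)
                  (trans (cong (K₀ [_]) (swap X Y)) (sym (⊚-[] K₀ (G Y) X)))

  locate : ∀ K L → K [ W ] ≡ L [ fma A ] → Overlap K W L A
  locate ∙ L eq = nested L eq refl
  locate (K ,ₗ V) (L ,ₗ _) eq with ,,-injective eq
  ... | eq′ , refl = overlap-⊚ (∙ ,ₗ V) (locate K L eq′)
  locate (K ,ₗ _) (_ ,ᵣ L) eq with ,,-injective eq
  ... | refl , eq′ =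
    apart (λ X → (K [ X ]) ,ᵣ L) (λ Y → K ,ₗ (L [ Y ])) (λ _ _ → refl)
      (cong (K ,ₗ_) eq′) refl
  locate (V ,ᵣ K) (_ ,ᵣ L) eq with ,,-injective eq
  ... | refl , eq′ = overlap-⊚ (V ,ᵣ ∙) (locate K L eq′)
  locate (_ ,ᵣ K) (L ,ₗ _) eq with ,,-injective eq
  ... | eq′ , refl =
    apart (λ X → L ,ₗ (K [ X ])) (λ Y → (L [ Y ]) ,ᵣ K) (λ _ _ → refl)
      (cong (_,ᵣ K) eq′) refl
  locate (K ︔ₗ V) (L ︔ₗ _) eq with ︔-injective eq
  ... | eq′ , refl = overlap-⊚ (∙ ︔ₗ V) (locate K L eq′)
  locate (K ︔ₗ _) (_ ︔ᵣ L) eq with ︔-injective eq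
  ... | refl , eq′ =
    apart (λ X → (K [ X ]) ︔ᵣ L) (λ Y → K ︔ₗ (L [ Y ])) (λ _ _ → refl)
      (cong (K ︔ₗ_) eq′) refl
  locate (V ︔ᵣ K) (_ ︔ᵣ L) eq with ︔-injective eq
  ... | refl , eq′ = overlap-⊚ (V ︔ᵣ ∙) (locate K L eq′)
  locate (_ ︔ᵣ K) (L ︔ₗ _) eq with ︔-injective eq
  ... | eq′ , refl =
    apart (λ X → L ︔ₗ (K [ X ])) (λ Y → (L [ Y ]) ︔ᵣ K) (λ _ _ → refl)
      (cong (_︔ᵣ K) eq′) refl
  locate (_ ,ₗ _) ∙ ()
  locate (_ ,ₗ _) (_ ︔ₗ _) ()
  locate (_ ,ₗ _) (_ ︔ᵣ _) ()
  locate (_ ,ᵣ _) ∙ ()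
  locate (_ ,ᵣ _) (_ ︔ₗ _) ()
  locate (_ ,ᵣ _) (_ ︔ᵣ _) ()
  locate (_ ︔ₗ _) ∙ ()
  locate (_ ︔ₗ _) (_ ,ₗ _) ()
  locate (_ ︔ₗ _) (_ ,ᵣ _) ()
  locate (_ ︔ᵣ _) ∙ ()
  locate (_ ︔ᵣ _) (_ ,ₗ _) ()
  locate (_ ︔ᵣ _) (_ ,ᵣ _) ()

  SubtreeRule : Tree → Tree → Fma → Set
  SubtreeRule W′ W C = ∀ M → M [ W′ ] ⊢T C → M [ W ] ⊢T C

  cut-past-rule : SubtreeRule W′ W C
    → (∀ M → K [ W′ ] ≡ M [ fma A ] → M [ U ] ⊢T C)
    → (∀ M → W ≡ M [ fma A ] → K [ M [ U ] ] ⊢T C)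
    → Overlap K W L A → L [ U ] ⊢T C
  cut-past-rule {K = K} {U = U} rule cut-premise cut-active (nested M inW refl) =
    cast (sym (⊚-[] K M U)) (cut-active M inW)
  cut-past-rule {W′ = W′} {W = W} {A = A} {U = U} rule cut-premise cut-active
                (apart F G swap refl refl) =
    cast (sym (swap W U))
      (rule (G U) (cast (swap W′ U) (cut-premise (F W′) (sym (swap W′ (fma A))))))

  data Principal : Fma → Ctx → Fma → Set where
    viaIL  : ∀ K → K [ ─ ] ⊢T C → Principal I K C
    via⊗LL : ∀ K → K [ fma A ,, fma B ] ⊢T C → Principal (A ⊗L B) K C
    via⊗RL : ∀ K → K [ fma A ︔ fma B ] ⊢T C → Principal (A ⊗R B) K C
    via⊸LL : ∀ K → U ⊢T A → K [ fma B ] ⊢T C → Principal (A ⊸L B) (K ⊚ (∙ ,ₗ U)) C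
    via⊸RL : ∀ K → U ⊢T A → K [ fma B ] ⊢T C → Principal (A ⊸R B) (K ⊚ (∙ ︔ₗ U)) C

  principal⇒⊢T : Principal A K C → K [ fma A ] ⊢T C
  principal⇒⊢T (viaIL K p) = IL K p
  principal⇒⊢T (via⊗LL K p) = ⊗LL K p
  principal⇒⊢T (via⊗RL K p) = ⊗RL K p
  principal⇒⊢T {A = A} (via⊸LL {U = U} K s p) =
    cast (sym (⊚-[] K (∙ ,ₗ U) (fma A))) (⊸LL K s p)
  principal⇒⊢T {A = A} (via⊸RL {U = U} K s p) =
    cast (sym (⊚-[] K (∙ ︔ₗ U) (fma A))) (⊸RL K s p)

  apply-under : ∀ K L → SubtreeRule W′ W C → K [ L [ W′ ] ] ⊢T C → K [ L [ W ] ] ⊢T C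
  apply-under {W′ = W′} {W = W} K L rule p =
    cast (⊚-[] K L W) (rule (K ⊚ L) (cast (sym (⊚-[] K L W′)) p))

  -- Termination: the cut formula decreases, or it stays fixed and cut-at recurses on the
  -- right derivation, cut-principal on the left one.
  mutual
    cut : ∀ K → U ⊢T A → K [ fma A ] ⊢T C → K [ U ] ⊢T C
    cut K u p = cut-at u p K refl

    cut-in : ∀ K M → U ⊢T A → K [ M [ fma A ] ] ⊢T C → K [ M [ U ] ] ⊢T C
    cut-in {U = U} {A = A} K M u p =
      cast (⊚-[] K M U) (cut-at u p (K ⊚ M) (sym (⊚-[] K M (fma A))))

    cut-at : U ⊢T A → V ⊢T C → ∀ L → V ≡ L [ fma A ] → L [ U ] ⊢T C
    cut-at u ax ∙ refl = u
    cut-at u (⊗LR p q) (L ,ₗ _) refl = ⊗LR (cut-at u p L refl) q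
    cut-at u (⊗LR p q) (_ ,ᵣ L) refl = ⊗LR p (cut-at u q L refl)
    cut-at u (⊗RR p q) (L ︔ₗ _) refl = ⊗RR (cut-at u p L refl) q
    cut-at u (⊗RR p q) (_ ︔ᵣ L) refl = ⊗RR p (cut-at u q L refl)
    cut-at u (⊸LR p) L refl = ⊸LR (cut-at u p (L ,ₗ _) refl)
    cut-at u (⊸RR p) L refl = ⊸RR (cut-at u p (L ︔ₗ _) refl)
    cut-at u (IL K p) L eq =
      cut-past-rule (λ M → IL M) (cut-at u p) (cut-active-fma u (viaIL K p)) (locate K L eq)
    cut-at u (⊗LL K p) L eq =
      cut-past-rule (λ M → ⊗LL M) (cut-at u p) (cut-active-fma u (via⊗LL K p)) (locate K L eq)
    cut-at u (⊗RL K p) L eq =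
      cut-past-rule (λ M → ⊗RL M) (cut-at u p) (cut-active-fma u (via⊗RL K p)) (locate K L eq)
    cut-at u (⊸LL K s p) L eq =
      cut-past-rule (λ M → ⊸LL M s) (cut-at u p) (cut-active-⊸LL u K s p) (locate K L eq)
    cut-at u (⊸RL K s p) L eq =
      cut-past-rule (λ M → ⊸RL M s) (cut-at u p) (cut-active-⊸RL u K s p) (locate K L eq)
    cut-at u (assocL K p) L eq =
      cut-past-rule (λ M → assocL M) (cut-at u p) (cut-active-assocL u K p) (locate K L eq)
    cut-at u (assocR K p) L eq =
      cut-past-rule (λ M → assocR M) (cut-at u p) (cut-active-assocR u K p) (locate K L eq)
    cut-at u (comm K p) L eq =
      cut-past-rule (λ M → comm M) (cut-at u p) (cut-active-comm u K p) (locate K L eq)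
    cut-at u (comm⁻¹ K p) L eq =
      cut-past-rule (λ M → comm⁻¹ M) (cut-at u p) (cut-active-comm⁻¹ u K p) (locate K L eq)
    cut-at u (unitLL K p) L eq =
      cut-past-rule (λ M → unitLL M) (cut-at u p) (cut-active-unitLL u K p) (locate K L eq)
    cut-at u (unitRL K p) L eq =
      cut-past-rule (λ M → unitRL M) (cut-at u p) (cut-active-unitRL u K p) (locate K L eq)
    cut-at u (unitLR K p) L eq =
      cut-past-rule (λ M → unitLR M) (cut-at u p) (cut-active-unitLR u K p) (locate K L eq)
    cut-at u (unitRR K p) L eq =
      cut-past-rule (λ M → unitRR M) (cut-at u p) (cut-active-unitRR u K p) (locate K L eq)
    cut-at u ax (_ ,ₗ _) ()
    cut-at u ax (_ ,ᵣ _) ()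
    cut-at u ax (_ ︔ₗ _) ()
    cut-at u ax (_ ︔ᵣ _) ()
    cut-at u IR ∙ ()
    cut-at u IR (_ ,ₗ _) ()
    cut-at u IR (_ ,ᵣ _) ()
    cut-at u IR (_ ︔ₗ _) ()
    cut-at u IR (_ ︔ᵣ _) ()
    cut-at u (⊗LR _ _) ∙ ()
    cut-at u (⊗LR _ _) (_ ︔ₗ _) ()
    cut-at u (⊗LR _ _) (_ ︔ᵣ _) ()
    cut-at u (⊗RR _ _) ∙ ()
    cut-at u (⊗RR _ _) (_ ,ₗ _) ()
    cut-at u (⊗RR _ _) (_ ,ᵣ _) ()

    cut-principal : U ⊢T A → Principal A K C → K [ U ] ⊢T C
    cut-principal ax pr = principal⇒⊢T pr
    cut-principal IR (viaIL K p) = p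
    cut-principal (⊗LR {T = U₁} u₁ u₂) (via⊗LL K p) =
      cut-in K (U₁ ,ᵣ ∙) u₂ (cut-in K (∙ ,ₗ _) u₁ p)
    cut-principal (⊗RR {T = U₁} u₁ u₂) (via⊗RL K p) =
      cut-in K (U₁ ︔ᵣ ∙) u₂ (cut-in K (∙ ︔ₗ _) u₁ p)
    cut-principal {U = U} (⊸LR u) (via⊸LL {U = U′} K s p) =
      cast (sym (⊚-[] K (∙ ,ₗ U′) U)) (cut K (cut (U ,ᵣ ∙) s u) p)
    cut-principal {U = U} (⊸RR u) (via⊸RL {U = U′} K s p) =
      cast (sym (⊚-[] K (∙ ︔ₗ U′) U)) (cut K (cut (U ︔ᵣ ∙) s u) p)
    cut-principal {K = K} (IL L u) pr = apply-under K L (λ M → IL M) (cut-principal u pr)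
    cut-principal {K = K} (⊗LL L u) pr = apply-under K L (λ M → ⊗LL M) (cut-principal u pr)
    cut-principal {K = K} (⊗RL L u) pr = apply-under K L (λ M → ⊗RL M) (cut-principal u pr)
    cut-principal {K = K} (⊸LL L s u) pr = apply-under K L (λ M → ⊸LL M s) (cut-principal u pr)
    cut-principal {K = K} (⊸RL L s u) pr = apply-under K L (λ M → ⊸RL M s) (cut-principal u pr)
    cut-principal {K = K} (assocL L u) pr = apply-under K L (λ M → assocL M) (cut-principal u pr)
    cut-principal {K = K} (assocR L u) pr = apply-under K L (λ M → assocR M) (cut-principal u pr)
    cut-principal {K = K} (comm L u) pr = apply-under K L (λ M → comm M) (cut-principal u pr)
    cut-principal {K = K} (comm⁻¹ L u) pr = apply-under K L (λ M → comm⁻¹ M) (cut-principal u pr)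
    cut-principal {K = K} (unitLL L u) pr = apply-under K L (λ M → unitLL M) (cut-principal u pr)
    cut-principal {K = K} (unitRL L u) pr = apply-under K L (λ M → unitRL M) (cut-principal u pr)
    cut-principal {K = K} (unitLR L u) pr = apply-under K L (λ M → unitLR M) (cut-principal u pr)
    cut-principal {K = K} (unitRR L u) pr = apply-under K L (λ M → unitRR M) (cut-principal u pr)

    cut-active-fma : U ⊢T A → Principal B K C
      → ∀ M → fma B ≡ M [ fma A ] → K [ M [ U ] ] ⊢T C
    cut-active-fma u pr ∙ refl = cut-principal u pr
    cut-active-fma u pr (_ ,ₗ _) ()
    cut-active-fma u pr (_ ,ᵣ _) ()
    cut-active-fma u pr (_ ︔ₗ _) ()
    cut-active-fma u pr (_ ︔ᵣ _) ()

    cut-active-⊸LL : U ⊢T A → ∀ K → U′ ⊢T X → K [ fma Y ] ⊢T C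
      → ∀ M → fma (X ⊸L Y) ,, U′ ≡ M [ fma A ] → K [ M [ U ] ] ⊢T C
    cut-active-⊸LL {U = U} {U′ = U′} u K s p (∙ ,ₗ _) refl =
      cast (⊚-[] K (∙ ,ₗ U′) U) (cut-principal u (via⊸LL K s p))
    cut-active-⊸LL u K s p (_ ,ᵣ M) refl = ⊸LL K (cut M u s) p
    cut-active-⊸LL u K s p ∙ ()
    cut-active-⊸LL u K s p ((_ ,ₗ _) ,ₗ _) ()
    cut-active-⊸LL u K s p ((_ ,ᵣ _) ,ₗ _) ()
    cut-active-⊸LL u K s p ((_ ︔ₗ _) ,ₗ _) ()
    cut-active-⊸LL u K s p ((_ ︔ᵣ _) ,ₗ _) ()
    cut-active-⊸LL u K s p (_ ︔ₗ _) ()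
    cut-active-⊸LL u K s p (_ ︔ᵣ _) ()

    cut-active-⊸RL : U ⊢T A → ∀ K → U′ ⊢T X → K [ fma Y ] ⊢T C
      → ∀ M → fma (X ⊸R Y) ︔ U′ ≡ M [ fma A ] → K [ M [ U ] ] ⊢T C
    cut-active-⊸RL {U = U} {U′ = U′} u K s p (∙ ︔ₗ _) refl =
      cast (⊚-[] K (∙ ︔ₗ U′) U) (cut-principal u (via⊸RL K s p))
    cut-active-⊸RL u K s p (_ ︔ᵣ M) refl = ⊸RL K (cut M u s) p
    cut-active-⊸RL u K s p ∙ ()
    cut-active-⊸RL u K s p ((_ ,ₗ _) ︔ₗ _) ()
    cut-active-⊸RL u K s p ((_ ,ᵣ _) ︔ₗ _) ()
    cut-active-⊸RL u K s p ((_ ︔ₗ _) ︔ₗ _) ()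
    cut-active-⊸RL u K s p ((_ ︔ᵣ _) ︔ₗ _) ()
    cut-active-⊸RL u K s p (_ ,ₗ _) ()
    cut-active-⊸RL u K s p (_ ,ᵣ _) ()

    cut-active-assocL : ∀ {U₀ U₁ U₂} → U ⊢T A → ∀ K → K [ U₀ ,, (U₁ ,, U₂) ] ⊢T C
      → ∀ M → (U₀ ,, U₁) ,, U₂ ≡ M [ fma A ] → K [ M [ U ] ] ⊢T C
    cut-active-assocL {U₁ = U₁} {U₂} u K p ((M ,ₗ _) ,ₗ _) refl =
      assocL K (cut-in K (M ,ₗ (U₁ ,, U₂)) u p)
    cut-active-assocL {U₀ = U₀} {U₂ = U₂} u K p ((_ ,ᵣ M) ,ₗ _) refl =
      assocL K (cut-in K (U₀ ,ᵣ (M ,ₗ U₂)) u p)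
    cut-active-assocL {U₀ = U₀} {U₁} u K p (_ ,ᵣ M) refl =
      assocL K (cut-in K (U₀ ,ᵣ (U₁ ,ᵣ M)) u p)
    cut-active-assocL u K p ∙ ()
    cut-active-assocL u K p (∙ ,ₗ _) ()
    cut-active-assocL u K p ((_ ︔ₗ _) ,ₗ _) ()
    cut-active-assocL u K p ((_ ︔ᵣ _) ,ₗ _) ()
    cut-active-assocL u K p (_ ︔ₗ _) ()
    cut-active-assocL u K p (_ ︔ᵣ _) ()

    cut-active-assocR : ∀ {U₀ U₁ U₂} → U ⊢T A → ∀ K → K [ (U₀ ︔ U₁) ︔ U₂ ] ⊢T C
      → ∀ M → U₀ ︔ (U₁ ︔ U₂) ≡ M [ fma A ] → K [ M [ U ] ] ⊢T C
    cut-active-assocR {U₁ = U₁} {U₂} u K p (M ︔ₗ _) refl =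
      assocR K (cut-in K ((M ︔ₗ U₁) ︔ₗ U₂) u p)
    cut-active-assocR {U₀ = U₀} {U₂ = U₂} u K p (_ ︔ᵣ (M ︔ₗ _)) refl =
      assocR K (cut-in K ((U₀ ︔ᵣ M) ︔ₗ U₂) u p)
    cut-active-assocR {U₀ = U₀} {U₁} u K p (_ ︔ᵣ (_ ︔ᵣ M)) refl =
      assocR K (cut-in K ((U₀ ︔ U₁) ︔ᵣ M) u p)
    cut-active-assocR u K p ∙ ()
    cut-active-assocR u K p (_ ︔ᵣ ∙) ()
    cut-active-assocR u K p (_ ︔ᵣ (_ ,ₗ _)) ()
    cut-active-assocR u K p (_ ︔ᵣ (_ ,ᵣ _)) ()
    cut-active-assocR u K p (_ ,ₗ _) ()
    cut-active-assocR u K p (_ ,ᵣ _) ()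

    cut-active-comm : ∀ {U₀ U₁} → U ⊢T A → ∀ K → K [ U₀ ,, U₁ ] ⊢T C
      → ∀ M → U₁ ︔ U₀ ≡ M [ fma A ] → K [ M [ U ] ] ⊢T C
    cut-active-comm {U₀ = U₀} u K p (M ︔ₗ _) refl = comm K (cut-in K (U₀ ,ᵣ M) u p)
    cut-active-comm {U₁ = U₁} u K p (_ ︔ᵣ M) refl = comm K (cut-in K (M ,ₗ U₁) u p)
    cut-active-comm u K p ∙ ()
    cut-active-comm u K p (_ ,ₗ _) ()
    cut-active-comm u K p (_ ,ᵣ _) ()

    cut-active-comm⁻¹ : ∀ {U₀ U₁} → U ⊢T A → ∀ K → K [ U₁ ︔ U₀ ] ⊢T C
      → ∀ M → U₀ ,, U₁ ≡ M [ fma A ] → K [ M [ U ] ] ⊢T C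
    cut-active-comm⁻¹ {U₁ = U₁} u K p (M ,ₗ _) refl = comm⁻¹ K (cut-in K (U₁ ︔ᵣ M) u p)
    cut-active-comm⁻¹ {U₀ = U₀} u K p (_ ,ᵣ M) refl = comm⁻¹ K (cut-in K (M ︔ₗ U₀) u p)
    cut-active-comm⁻¹ u K p ∙ ()
    cut-active-comm⁻¹ u K p (_ ︔ₗ _) ()
    cut-active-comm⁻¹ u K p (_ ︔ᵣ _) ()

    cut-active-unitLL : U ⊢T A → ∀ K → K [ U′ ] ⊢T C
      → ∀ M → ─ ,, U′ ≡ M [ fma A ] → K [ M [ U ] ] ⊢T C
    cut-active-unitLL u K p (_ ,ᵣ M) refl = unitLL K (cut-in K M u p)
    cut-active-unitLL u K p (M ,ₗ _) eq =
      ⊥-elim (─≢[fma] M (proj₁ (,,-injective eq)))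
    cut-active-unitLL u K p ∙ ()
    cut-active-unitLL u K p (_ ︔ₗ _) ()
    cut-active-unitLL u K p (_ ︔ᵣ _) ()

    cut-active-unitRL : U ⊢T A → ∀ K → K [ U′ ,, ─ ] ⊢T C
      → ∀ M → U′ ≡ M [ fma A ] → K [ M [ U ] ] ⊢T C
    cut-active-unitRL u K p M refl = unitRL K (cut-in K (M ,ₗ ─) u p)

    cut-active-unitLR : U ⊢T A → ∀ K → K [ U′ ] ⊢T C
      → ∀ M → U′ ︔ ─ ≡ M [ fma A ] → K [ M [ U ] ] ⊢T C
    cut-active-unitLR u K p (M ︔ₗ _) refl = unitLR K (cut-in K M u p)
    cut-active-unitLR u K p (_ ︔ᵣ M) eq =
      ⊥-elim (─≢[fma] M (proj₂ (︔-injective eq)))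
    cut-active-unitLR u K p ∙ ()
    cut-active-unitLR u K p (_ ,ₗ _) ()
    cut-active-unitLR u K p (_ ,ᵣ _) ()

    cut-active-unitRR : U ⊢T A → ∀ K → K [ ─ ︔ U′ ] ⊢T C
      → ∀ M → U′ ≡ M [ fma A ] → K [ M [ U ] ] ⊢T C
    cut-active-unitRR u K p M refl = unitRR K (cut-in K (─ ︔ᵣ M) u p)

  ⊢L⇒⊢T : A ⊢L C → fma A ⊢T C
  ⊢L⇒⊢T id = ax
  ⊢L⇒⊢T (comp f g) = cut ∙ (⊢L⇒⊢T f) (⊢L⇒⊢T g)
  ⊢L⇒⊢T (⊗L-f f g) = ⊗LL ∙ (⊗LR (⊢L⇒⊢T f) (⊢L⇒⊢T g))
  ⊢L⇒⊢T (⊸L-f f g) = ⊸LR (⊸LL ∙ (⊢L⇒⊢T f) (⊢L⇒⊢T g))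
  ⊢L⇒⊢T (⊸R-f f g) = ⊸RR (⊸RL ∙ (⊢L⇒⊢T f) (⊢L⇒⊢T g))
  ⊢L⇒⊢T (λ' {A}) = ⊗LL ∙ (IL (∙ ,ₗ fma A) (unitLL ∙ ax))
  ⊢L⇒⊢T ρ = unitRL ∙ (⊗LR ax IR)
  ⊢L⇒⊢T (α {C = C}) =
    ⊗LL ∙ (⊗LL (∙ ,ₗ fma C) (assocL ∙ (⊗LR ax (⊗LR ax ax))))
  ⊢L⇒⊢T γ = ⊗LL ∙ (comm⁻¹ ∙ (⊗RR ax ax))
  ⊢L⇒⊢T γ⁻¹ = ⊗RL ∙ (comm ∙ (⊗LR ax ax))
  ⊢L⇒⊢T (π f) = ⊸LR (cut ∙ (⊗LR ax ax) (⊢L⇒⊢T f))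
  ⊢L⇒⊢T (π⁻¹ {B = B} f) = ⊗LL ∙ (cut (∙ ,ₗ fma B) (⊢L⇒⊢T f) (⊸LL ∙ ax ax))
  ⊢L⇒⊢T (πR f) = ⊸RR (cut ∙ (⊗RR ax ax) (⊢L⇒⊢T f))
  ⊢L⇒⊢T (πR⁻¹ {B = B} f) = ⊗RL ∙ (cut (∙ ︔ₗ fma B) (⊢L⇒⊢T f) (⊸RL ∙ ax ax))

  ⊗R-f : A ⊢L C → A′ ⊢L C′ → A ⊗R A′ ⊢L C ⊗R C′
  ⊗R-f f g = comp γ⁻¹ (comp (⊗L-f g f) γ)

  αR : A ⊗R (B ⊗R C) ⊢L (A ⊗R B) ⊗R C
  αR = comp γ⁻¹ (comp (⊗L-f γ⁻¹ id) (comp α (comp (⊗L-f id γ) γ)))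

  λR : A ⊗R I ⊢L A
  λR = comp γ⁻¹ λ'

  ρR : A ⊢L I ⊗R A
  ρR = comp ρ γ

  evL : (A ⊸L B) ⊗L A ⊢L B
  evL = π⁻¹ id

  evR : (A ⊸R B) ⊗R A ⊢L B
  evR = πR⁻¹ id

  []-#-f : ∀ K → U # ⊢L V # → (K [ U ]) # ⊢L (K [ V ]) #
  []-#-f ∙ f = f
  []-#-f (K ,ₗ _) f = ⊗L-f ([]-#-f K f) id
  []-#-f (_ ,ᵣ K) f = ⊗L-f id ([]-#-f K f)
  []-#-f (K ︔ₗ _) f = ⊗R-f ([]-#-f K f) id
  []-#-f (_ ︔ᵣ K) f = ⊗R-f id ([]-#-f K f)

  ⊢T⇒⊢L : U ⊢T C → U # ⊢L C
  ⊢T⇒⊢L ax = id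
  ⊢T⇒⊢L IR = id
  ⊢T⇒⊢L (⊗LR p q) = ⊗L-f (⊢T⇒⊢L p) (⊢T⇒⊢L q)
  ⊢T⇒⊢L (⊗RR p q) = ⊗R-f (⊢T⇒⊢L p) (⊢T⇒⊢L q)
  ⊢T⇒⊢L (⊸LR p) = π (⊢T⇒⊢L p)
  ⊢T⇒⊢L (⊸RR p) = πR (⊢T⇒⊢L p)
  ⊢T⇒⊢L (IL K p) = comp ([]-#-f K id) (⊢T⇒⊢L p)
  ⊢T⇒⊢L (⊗LL K p) = comp ([]-#-f K id) (⊢T⇒⊢L p)
  ⊢T⇒⊢L (⊗RL K p) = comp ([]-#-f K id) (⊢T⇒⊢L p)
  ⊢T⇒⊢L (⊸LL K s p) =
    comp ([]-#-f K (comp (⊗L-f id (⊢T⇒⊢L s)) evL)) (⊢T⇒⊢L p)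
  ⊢T⇒⊢L (⊸RL K s p) =
    comp ([]-#-f K (comp (⊗R-f id (⊢T⇒⊢L s)) evR)) (⊢T⇒⊢L p)
  ⊢T⇒⊢L (assocL K p) = comp ([]-#-f K α) (⊢T⇒⊢L p)
  ⊢T⇒⊢L (assocR K p) = comp ([]-#-f K αR) (⊢T⇒⊢L p)
  ⊢T⇒⊢L (comm K p) = comp ([]-#-f K γ⁻¹) (⊢T⇒⊢L p)
  ⊢T⇒⊢L (comm⁻¹ K p) = comp ([]-#-f K γ) (⊢T⇒⊢L p)
  ⊢T⇒⊢L (unitLL K p) = comp ([]-#-f K λ') (⊢T⇒⊢L p)
  ⊢T⇒⊢L (unitRL K p) = comp ([]-#-f K ρ) (⊢T⇒⊢L p)
  ⊢T⇒⊢L (unitLR K p) = comp ([]-#-f K λR) (⊢T⇒⊢L p)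
  ⊢T⇒⊢L (unitRR K p) = comp ([]-#-f K ρR) (⊢T⇒⊢L p)

mainTheorem6 : (At : Set) → let open Calculi At in
    ((A C : Fma) → A ⊢L C → fma A ⊢T C)
    × ((T : Tree) (C : Fma) → T ⊢T C → (T #) ⊢L C)
mainTheorem6 At = (λ _ _ → ⊢L⇒⊢T) , (λ _ _ → ⊢T⇒⊢L)
  where open Equivalence At
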